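{- Let $m\ge 1$ and $r\ge 1$ be integers. For every integer $n\ge 0$, \begin{align*} \sum_{k=0}^{n}\binom{n}{k}\binom{n+k}{k}\left(\frac{m}{r}\right)^{k}\phi_{k}\!\left(\frac{x}{m}\right)&=\sum_{k=0}^{n}\binom{n}{k}\binom{n+k}{k}(-1)^{n-k}\frac{1}{r^{k}}D_{m,r}(k,x),\\ \sum_{k=0}^{n}\binom{n}{k}\binom{n+k}{k}x^{r}\frac{\phi_{k}(x)}{r^{k}}&=\sum_{k=0}^{n}\binom{n}{k}\binom{n+k}{k}(-1)^{n-k}\frac{1}{r^{k}}\sum_{j=0}^{r}s(r,j)\,\phi_{k+j}(x). \end{align*}
   Context: The $r$-Whitney numbers of the second kind are $W_{m,r}(n,k)=\sum_{j=k}^{n}\binom{n}{j}m^{j-k}r^{n-j}S(j,k)$, and the $r$-Dowling polynomials are $D_{m,r}(n,x)=\sum_{k=0}^{n}W_{m,r}(n,k)x^k$. The Bell polynomials are $\phi_n(x)=\sum_{k=0}^{n}S(n,k)x^k$, with $S(n,k)$ the Stirling numbers of the second kind; $s(n,k)$ are the signed Stirling numbers of the first kind, defined by $x(x-1)\cdots(x-n+1)=\sum_{k=0}^n s(n,k)x^k$. -}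

module Defs where

open import Data.Nat as ℕ using (ℕ; zero; suc)
open import Data.Integer as ℤ using (ℤ; +_)
open import Data.Rational using (ℚ; _/_; _+_; _*_; -_; 0ℚ; 1ℚ)
open import Data.Nat.Combinatorics using (_C_)
open import Data.Bool using (if_then_else_)

ℕ→ℚ : ℕ → ℚ
ℕ→ℚ n = + n / 1

ℤ→ℚ : ℤ → ℚ
ℤ→ℚ z = z / 1

infixr 8 _^_
_^_ : ℚ → ℕ → ℚ
q ^ zero = 1ℚ
q ^ suc n = q * (q ^ n)

sgn : ℕ → ℚ
sgn zero = 1ℚ
sgn (suc n) = - sgn n

Σ[≤] : ℕ → (ℕ → ℚ) → ℚ
Σ[≤] zero f = f 0
Σ[≤] (suc n) f = Σ[≤] n f + f (suc n)

-- Σ_{j=k}^{n} f j  (empty sum = 0 if k > n)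
Σ[from_to_] : ℕ → ℕ → (ℕ → ℕ) → ℕ
Σ[from k to zero ] f = if k ℕ.≤ᵇ 0 then f 0 else 0
Σ[from k to suc n ] f = Σ[from k to n ] f ℕ.+ (if k ℕ.≤ᵇ suc n then f (suc n) else 0)

S : ℕ → ℕ → ℕ
S zero zero = 1
S zero (suc k) = 0
S (suc n) zero = 0
S (suc n) (suc k) = suc k ℕ.* S n (suc k) ℕ.+ S n k

-- signed Stirling numbers of the first kind s(n,k):
-- x(x-1)...(x-n+1) = Σ_k s(n,k) x^k
s : ℕ → ℕ → ℤ
s zero zero = + 1
s zero (suc k) = + 0
s (suc n) zero = + 0
s (suc n) (suc k) = s n k ℤ.- (+ n) ℤ.* s n (suc k)

φ : ℕ → ℚ → ℚ
φ n x = Σ[≤] n (λ k → ℕ→ℚ (S n k) * x ^ k)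

W : ℕ → ℕ → ℕ → ℕ → ℕ
W m r n k = Σ[from k to n ] (λ j → (n C j) ℕ.* (m ℕ.^ (j ℕ.∸ k)) ℕ.* (r ℕ.^ (n ℕ.∸ j)) ℕ.* S j k)

D : ℕ → ℕ → ℕ → ℚ → ℚ
D m r n x = Σ[≤] n (λ k → ℕ→ℚ (W m r n k) * x ^ k)

module Submission where

-- Both identities are instances of one inversion formula.  Writing
-- w(n,k) = C(n,k) C(n+k,k), the column sums of the kernel (-1)^(n-k) w(n,k) C(k,j)
-- equal w(n,j) (by trinomial revision and an alternating Vandermonde sum), hence
-- for every sequence b
--   Σ_k w(n,k) b_k = Σ_k w(n,k) (-1)^(n-k) Σ_{i≤k} C(k,i) b_i.          (inversion)
-- With the binomial transform BT g a k = Σ_i C(k,i) a^(k-i) g_i and R·ρ = 1 one has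
-- ρ^k · BT g R k = Σ_i C(k,i) ρ^i g_i, so (inversion) for b_k = ρ^k g_k has right
-- side Σ_k w(n,k) (-1)^(n-k) ρ^k BT g R k.  It remains to recognise two transforms
-- with R = r, ρ = 1/r:
--   D_{m,r}(k,x)          = BT (i ↦ m^i φ_i(x/m)) r k         (module Dowling),
--   Σ_j s(r,j) φ_{k+j}(x) = x^r · BT (i ↦ φ_i(x)) r k         (module StirlingBell),
-- the latter by induction on r, using the Bell recurrence φ_{n+1} = x · BT φ 1 n and
-- the composition law BT (BT g b) a = BT g (a+b).

open import Defs

module FiniteSums where

  open import Data.Nat using (ℕ; zero; suc; z≤n; s≤s) renaming (_+_ to _+ℕ_; _≤_ to _≤ℕ_; _<_ to _<ℕ_)
  import Data.Nat.Properties as NP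
  open import Data.Rational using (ℚ; _+_; _*_; 0ℚ; -_)
  import Data.Rational.Properties as QP
  open import Data.Rational.Solver using (module +-*-Solver)
  open import Data.Sum using (inj₁; inj₂)
  open import Relation.Binary.PropositionalEquality

  Σ-cong : ∀ n {f g : ℕ → ℚ} → (∀ k → f k ≡ g k) → Σ[≤] n f ≡ Σ[≤] n g
  Σ-cong zero    e = e 0
  Σ-cong (suc n) e = cong₂ _+_ (Σ-cong n e) (e (suc n))

  Σ-cong-≤ : ∀ n {f g : ℕ → ℚ} → (∀ k → k ≤ℕ n → f k ≡ g k) → Σ[≤] n f ≡ Σ[≤] n g
  Σ-cong-≤ zero    e = e 0 z≤n
  Σ-cong-≤ (suc n) e =
    cong₂ _+_ (Σ-cong-≤ n (λ k k≤n → e k (NP.m≤n⇒m≤1+n k≤n))) (e (suc n) NP.≤-refl)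

  Σ-+ : ∀ n (f g : ℕ → ℚ) → Σ[≤] n (λ k → f k + g k) ≡ Σ[≤] n f + Σ[≤] n g
  Σ-+ zero    f g = refl
  Σ-+ (suc n) f g = trans (cong (_+ (f (suc n) + g (suc n))) (Σ-+ n f g))
    (solve 4 (λ a b c d → (a :+ b) :+ (c :+ d) := (a :+ c) :+ (b :+ d)) refl
       (Σ[≤] n f) (Σ[≤] n g) (f (suc n)) (g (suc n)))
    where open +-*-Solver

  Σ-*ˡ : ∀ n c (f : ℕ → ℚ) → c * Σ[≤] n f ≡ Σ[≤] n (λ k → c * f k)
  Σ-*ˡ zero    c f = refl
  Σ-*ˡ (suc n) c f = trans (QP.*-distribˡ-+ c _ _) (cong (_+ (c * f (suc n))) (Σ-*ˡ n c f))

  Σ-*ʳ : ∀ n (f : ℕ → ℚ) c → Σ[≤] n (λ k → f k * c) ≡ Σ[≤] n f * c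
  Σ-*ʳ n f c = trans (Σ-cong n (λ k → QP.*-comm (f k) c))
    (trans (sym (Σ-*ˡ n c f)) (QP.*-comm c (Σ[≤] n f)))

  Σ-neg : ∀ n (f : ℕ → ℚ) → - Σ[≤] n f ≡ Σ[≤] n (λ k → - f k)
  Σ-neg zero    f = refl
  Σ-neg (suc n) f =
    trans (QP.neg-distrib-+ (Σ[≤] n f) (f (suc n))) (cong (_+ (- f (suc n))) (Σ-neg n f))

  Σ-zero : ∀ n (f : ℕ → ℚ) → (∀ k → f k ≡ 0ℚ) → Σ[≤] n f ≡ 0ℚ
  Σ-zero zero    f e = e 0
  Σ-zero (suc n) f e = cong₂ _+_ (Σ-zero n f e) (e (suc n))

  Σ-sucˡ : ∀ n (f : ℕ → ℚ) → Σ[≤] (suc n) f ≡ f 0 + Σ[≤] n (λ k → f (suc k))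
  Σ-sucˡ zero    f = refl
  Σ-sucˡ (suc n) f = trans (cong (_+ f (suc (suc n))) (Σ-sucˡ n f))
    (QP.+-assoc (f 0) (Σ[≤] n (λ k → f (suc k))) (f (suc (suc n))))

  Σ-swap : ∀ n m (f : ℕ → ℕ → ℚ) →
    Σ[≤] n (λ i → Σ[≤] m (f i)) ≡ Σ[≤] m (λ j → Σ[≤] n (λ i → f i j))
  Σ-swap zero    m f = refl
  Σ-swap (suc n) m f = trans (cong (_+ Σ[≤] m (f (suc n))) (Σ-swap n m f))
    (sym (Σ-+ m (λ j → Σ[≤] n (λ i → f i j)) (f (suc n))))

  Σ-extend : ∀ n N (f : ℕ → ℚ) → n ≤ℕ N → (∀ k → n <ℕ k → f k ≡ 0ℚ) → Σ[≤] N f ≡ Σ[≤] n f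
  Σ-extend zero    zero    f z≤n e = refl
  Σ-extend n       (suc N) f n≤N e with NP.m≤n⇒m<n∨m≡n n≤N
  ... | inj₂ refl          = refl
  ... | inj₁ (s≤s n≤N) = trans (cong₂ _+_ (Σ-extend n N f n≤N e) (e (suc N) (s≤s n≤N)))
    (QP.+-identityʳ _)

  Σ-shift : ∀ j N (f : ℕ → ℚ) → (∀ k → k <ℕ j → f k ≡ 0ℚ) →
    Σ[≤] (j +ℕ N) f ≡ Σ[≤] N (λ t → f (j +ℕ t))
  Σ-shift zero    N f e = refl
  Σ-shift (suc j) N f e = trans (Σ-sucˡ (j +ℕ N) f)
    (trans (cong₂ _+_ (e 0 (s≤s z≤n)) (Σ-shift j N (λ k → f (suc k)) (λ k k<j → e (suc k) (s≤s k<j))))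
           (QP.+-identityˡ _))

module Binomial where

  open import Data.Nat
  import Data.Nat.Properties as NP
  open import Data.Nat.Combinatorics using (_C_; nCk+nC[k+1]≡[n+1]C[k+1])
  open import Data.Nat.Solver using (module +-*-Solver)
  open import Relation.Binary.PropositionalEquality

  -- Binomial coefficients defined by Pascal's rule, so that the rule holds by computation.
  binom : ℕ → ℕ → ℕ
  binom n       zero    = 1
  binom zero    (suc k) = 0
  binom (suc n) (suc k) = binom n k + binom n (suc k)

  C≡binom : ∀ n k → n C k ≡ binom n k
  C≡binom n       zero    = refl
  C≡binom zero    (suc k) = refl
  C≡binom (suc n) (suc k) = trans (sym (nCk+nC[k+1]≡[n+1]C[k+1] n k))
    (cong₂ _+_ (C≡binom n k) (C≡binom n (suc k)))

  binom-vanish : ∀ n k → n < k → binom n k ≡ 0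
  binom-vanish zero    (suc k) _         = refl
  binom-vanish (suc n) (suc k) (s≤s n<k) =
    cong₂ _+_ (binom-vanish n k n<k) (binom-vanish n (suc k) (NP.m<n⇒m<1+n n<k))

  binom-diag : ∀ n → binom n n ≡ 1
  binom-diag zero    = refl
  binom-diag (suc n) = cong₂ _+_ (binom-diag n) (binom-vanish n (suc n) NP.≤-refl)

  -- The factorial formula C(a+b,a)·a!·b! = (a+b)!, from which the symmetry and
  -- trinomial-revision identities below follow by cancelling factorials.
  binom-factorial : ∀ a b → binom (a + b) a * (a ! * b !) ≡ (a + b) !
  binom-factorial zero    b = trans (NP.*-identityˡ _) (NP.*-identityˡ _)
  binom-factorial (suc a) zero = begin
      binom (suc a + 0) (suc a) * (suc a ! * 1) ≡⟨ cong (λ t → binom t (suc a) * (suc a ! * 1)) (NP.+-identityʳ (suc a)) ⟩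
      binom (suc a) (suc a) * (suc a ! * 1)     ≡⟨ cong (_* (suc a ! * 1)) (binom-diag (suc a)) ⟩
      1 * (suc a ! * 1)                         ≡⟨ trans (NP.*-identityˡ _) (NP.*-identityʳ _) ⟩
      suc a !                                   ≡⟨ cong _! (sym (NP.+-identityʳ (suc a))) ⟩
      (suc a + 0) ! ∎
    where open ≡-Reasoning
  binom-factorial (suc a) (suc b) = begin
      (binom n a + binom n (suc a)) * (suc a ! * suc b !)
    ≡⟨ NP.*-distribʳ-+ (suc a ! * suc b !) (binom n a) (binom n (suc a)) ⟩
      binom n a * (suc a ! * suc b !) + binom n (suc a) * (suc a ! * suc b !)
    ≡⟨ cong₂ _+_ left right ⟩
      suc a * n ! + suc b * n !
    ≡⟨ sym (NP.*-distribʳ-+ (n !) (suc a) (suc b)) ⟩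
      (suc a + suc b) * n !
    ≡⟨ cong (λ t → t * n !) (NP.+-suc (suc a) b) ⟩
      suc (suc a + b) * n !
    ≡⟨ cong (λ t → suc (suc a + b) * t !) (NP.+-suc a b) ⟩
      suc (suc a + b) !
    ≡⟨ cong _! (sym (NP.+-suc (suc a) b)) ⟩
      (suc a + suc b) ! ∎
    where
    open ≡-Reasoning
    open +-*-Solver
    n = a + suc b
    left : binom n a * (suc a ! * suc b !) ≡ suc a * n !
    left = trans (solve 4 (λ x y p q → x :* ((y :* p) :* q) := y :* (x :* (p :* q))) refl
                    (binom n a) (suc a) (a !) (suc b !))
                 (cong (suc a *_) (binom-factorial a (suc b)))
    right : binom n (suc a) * (suc a ! * suc b !) ≡ suc b * n !
    right = trans (solve 4 (λ x p y q → x :* (p :* (y :* q)) := y :* (x :* (p :* q))) refl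
                     (binom n (suc a)) (suc a !) (suc b) (b !))
                  (cong (suc b *_) (trans (cong (λ t → binom t (suc a) * (suc a ! * b !)) (NP.+-suc a b))
                     (trans (binom-factorial (suc a) b) (cong _! (sym (NP.+-suc a b))))))

  binom-sym : ∀ a b → binom (a + b) a ≡ binom (a + b) b
  binom-sym a b = NP.*-cancelʳ-≡ (binom (a + b) a) (binom (a + b) b) (a ! * b !)
    {{NP.m*n≢0 (a !) (b !) {{NP._!≢0 a}} {{NP._!≢0 b}}}} (begin
      binom (a + b) a * (a ! * b !) ≡⟨ binom-factorial a b ⟩
      (a + b) !                     ≡⟨ cong _! (NP.+-comm a b) ⟩
      (b + a) !                     ≡⟨ sym (binom-factorial b a) ⟩
      binom (b + a) b * (b ! * a !) ≡⟨ cong₂ (λ t u → binom t b * u) (NP.+-comm b a) (NP.*-comm (b !) (a !)) ⟩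
      binom (a + b) b * (a ! * b !) ∎)
    where open ≡-Reasoning

  binom-trinomial : ∀ a b c →
    binom (a + b + c) (a + b) * binom (a + b) a ≡ binom (a + (b + c)) a * binom (b + c) b
  binom-trinomial a b c = NP.*-cancelʳ-≡ _ _ (a ! * b ! * c !) {{factorials≢0}} (begin
      binom (a + b + c) (a + b) * binom (a + b) a * (a ! * b ! * c !)
    ≡⟨ solve 5 (λ x y p q r → x :* y :* (p :* q :* r) := x :* (y :* (p :* q) :* r)) refl
         (binom (a + b + c) (a + b)) (binom (a + b) a) (a !) (b !) (c !) ⟩
      binom (a + b + c) (a + b) * (binom (a + b) a * (a ! * b !) * c !)
    ≡⟨ cong (λ t → binom (a + b + c) (a + b) * (t * c !)) (binom-factorial a b) ⟩
      binom (a + b + c) (a + b) * ((a + b) ! * c !)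
    ≡⟨ binom-factorial (a + b) c ⟩
      (a + b + c) !
    ≡⟨ cong _! (NP.+-assoc a b c) ⟩
      (a + (b + c)) !
    ≡⟨ sym (binom-factorial a (b + c)) ⟩
      binom (a + (b + c)) a * (a ! * (b + c) !)
    ≡⟨ cong (λ t → binom (a + (b + c)) a * (a ! * t)) (sym (binom-factorial b c)) ⟩
      binom (a + (b + c)) a * (a ! * (binom (b + c) b * (b ! * c !)))
    ≡⟨ solve 5 (λ x y p q r → x :* (p :* (y :* (q :* r))) := x :* y :* (p :* q :* r)) refl
         (binom (a + (b + c)) a) (binom (b + c) b) (a !) (b !) (c !) ⟩
      binom (a + (b + c)) a * binom (b + c) b * (a ! * b ! * c !) ∎)
    where
    open ≡-Reasoning
    open +-*-Solver
    factorials≢0 : NonZero (a ! * b ! * c !)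
    factorials≢0 = NP.m*n≢0 (a ! * b !) (c !) {{NP.m*n≢0 (a !) (b !) {{NP._!≢0 a}} {{NP._!≢0 b}}}} {{NP._!≢0 c}}

module Embedding where

  open import Data.Nat as ℕ using (ℕ; zero; suc)
  import Data.Nat.Properties as NP
  open import Data.Integer as ℤ using (ℤ; +_)
  import Data.Integer.Properties as ZP
  open import Data.Rational using (ℚ; mkℚ; _/_; _+_; _*_; 0ℚ; 1ℚ; -_)
  import Data.Rational.Properties as QP
  import Data.Rational.Unnormalised as U
  import Data.Rational.Unnormalised.Properties as UP
  open import Data.Rational.Solver using (module +-*-Solver)
  open import Data.Nat.Coprimality using (1-coprimeTo) renaming (sym to coprime-sym)
  open import Relation.Binary.PropositionalEquality

  -- An integer over 1 is already in normal form; this makes ℤ→ℚ a ring homomorphism.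
  ℤ→ℚ-normal : ∀ z → ℤ→ℚ z ≡ mkℚ z 0 (coprime-sym (1-coprimeTo _))
  ℤ→ℚ-normal z = QP.↥p/↧p≡p (mkℚ z 0 (coprime-sym (1-coprimeTo _)))

  ℤ→ℚ-+ : ∀ a b → ℤ→ℚ (a ℤ.+ b) ≡ ℤ→ℚ a + ℤ→ℚ b
  ℤ→ℚ-+ a b rewrite ℤ→ℚ-normal a | ℤ→ℚ-normal b =
    cong₂ (λ u v → (u ℤ.+ v) / 1) (sym (ZP.*-identityʳ a)) (sym (ZP.*-identityʳ b))

  ℤ→ℚ-* : ∀ a b → ℤ→ℚ (a ℤ.* b) ≡ ℤ→ℚ a * ℤ→ℚ b
  ℤ→ℚ-* a b rewrite ℤ→ℚ-normal a | ℤ→ℚ-normal b = refl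

  ℤ→ℚ-neg : ∀ a → ℤ→ℚ (ℤ.- a) ≡ - ℤ→ℚ a
  ℤ→ℚ-neg a = trans (cong ℤ→ℚ (sym (ZP.-1*i≡-i a)))
    (trans (ℤ→ℚ-* (ℤ.- + 1) a)
    (trans (sym (QP.neg-distribˡ-* 1ℚ (ℤ→ℚ a))) (cong -_ (QP.*-identityˡ _))))

  ℤ→ℚ-- : ∀ a b → ℤ→ℚ (a ℤ.- b) ≡ ℤ→ℚ a + - ℤ→ℚ b
  ℤ→ℚ-- a b = trans (ℤ→ℚ-+ a (ℤ.- b)) (cong (λ t → ℤ→ℚ a + t) (ℤ→ℚ-neg b))

  -- An opaque copy of the embedding ℕ → ℚ: it keeps the normaliser from unfolding
  -- rational arithmetic on numerals; all reasoning about it goes through the laws below.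
  opaque
    ι : ℕ → ℚ
    ι = ℕ→ℚ

  opaque
    unfolding ι
    ι≡ℕ→ℚ : ∀ n → ι n ≡ ℕ→ℚ n
    ι≡ℕ→ℚ n = refl

    ι-0 : ι 0 ≡ 0ℚ
    ι-0 = refl

    ι-1 : ι 1 ≡ 1ℚ
    ι-1 = refl

    ι-+ : ∀ a b → ι (a ℕ.+ b) ≡ ι a + ι b
    ι-+ a b = ℤ→ℚ-+ (+ a) (+ b)

    ι-* : ∀ a b → ι (a ℕ.* b) ≡ ι a * ι b
    ι-* a b = trans (cong ℤ→ℚ (ZP.pos-* a b)) (ℤ→ℚ-* (+ a) (+ b))

  ι-^ : ∀ a b → ι (a ℕ.^ b) ≡ ι a ^ b
  ι-^ a zero    = ι-1
  ι-^ a (suc b) = trans (ι-* a (a ℕ.^ b)) (cong (ι a *_) (ι-^ a b))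

  ι-suc : ∀ n → ι (suc n) ≡ 1ℚ + ι n
  ι-suc n = trans (ι-+ 1 n) (cong (_+ ι n) ι-1)

  ι-zero-factor : ∀ a b c → b ≡ 0 → a * ι b * c ≡ 0ℚ
  ι-zero-factor a b c refl =
    trans (cong (λ z → a * z * c) ι-0) (trans (cong (_* c) (QP.*-zeroʳ a)) (QP.*-zeroˡ c))

  /-as-* : ∀ a d → (+ a / suc d) ≡ ℕ→ℚ a * (+ 1 / suc d)
  /-as-* a d = QP.toℚᵘ-injective (UP.≃-trans (QP.toℚᵘ-fromℚᵘ (U.mkℚᵘ (+ a) d))
    (UP.≃-sym (UP.≃-trans (QP.toℚᵘ-homo-* (ℕ→ℚ a) (+ 1 / suc d))
      (UP.≃-trans (UP.*-cong (QP.toℚᵘ-fromℚᵘ (U.mkℚᵘ (+ a) 0)) (QP.toℚᵘ-fromℚᵘ (U.mkℚᵘ (+ 1) d)))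
        (U.*≡* (cong₂ ℤ._*_ (ZP.*-identityʳ (+ a)) (cong (λ t → + suc t) (sym (NP.+-identityʳ d)))))))))

  ι-*-inverse : ∀ d → ι (suc d) * (+ 1 / suc d) ≡ 1ℚ
  ι-*-inverse d = trans (cong (_* (+ 1 / suc d)) (ι≡ℕ→ℚ (suc d))) (trans (sym (/-as-* (suc d) d))
    (QP.toℚᵘ-injective (UP.≃-trans (QP.toℚᵘ-fromℚᵘ (U.mkℚᵘ (+ suc d) d))
      (U.*≡* (ZP.*-comm (+ suc d) (+ 1))))))

  ^-+ : ∀ q a b → q ^ (a ℕ.+ b) ≡ q ^ a * q ^ b
  ^-+ q zero    b = sym (QP.*-identityˡ _)
  ^-+ q (suc a) b = trans (cong (q *_) (^-+ q a b)) (sym (QP.*-assoc q (q ^ a) (q ^ b)))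

  ^-distrib-* : ∀ p q a → (p * q) ^ a ≡ p ^ a * q ^ a
  ^-distrib-* p q zero    = refl
  ^-distrib-* p q (suc a) = trans (cong ((p * q) *_) (^-distrib-* p q a))
    (solve 4 (λ p q x y → (p :* q) :* (x :* y) := (p :* x) :* (q :* y)) refl p q (p ^ a) (q ^ a))
    where open +-*-Solver

  1^ : ∀ a → 1ℚ ^ a ≡ 1ℚ
  1^ zero    = refl
  1^ (suc a) = trans (QP.*-identityˡ _) (1^ a)

  ^-cancel : ∀ p q → p * q ≡ 1ℚ → ∀ i d → q ^ (i ℕ.+ d) * p ^ d ≡ q ^ i
  ^-cancel p q pq≡1 i d = begin
      q ^ (i ℕ.+ d) * p ^ d   ≡⟨ cong (_* p ^ d) (^-+ q i d) ⟩
      q ^ i * q ^ d * p ^ d   ≡⟨ QP.*-assoc (q ^ i) _ _ ⟩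
      q ^ i * (q ^ d * p ^ d) ≡⟨ cong (q ^ i *_) (sym (^-distrib-* q p d)) ⟩
      q ^ i * (q * p) ^ d     ≡⟨ cong (λ t → q ^ i * t ^ d) (trans (QP.*-comm q p) pq≡1) ⟩
      q ^ i * 1ℚ ^ d          ≡⟨ cong (q ^ i *_) (1^ d) ⟩
      q ^ i * 1ℚ              ≡⟨ QP.*-identityʳ _ ⟩
      q ^ i ∎
    where open ≡-Reasoning

module Inversion where

  open FiniteSums
  open Binomial
  open Embedding
  open import Data.Nat as ℕ using (ℕ; zero; suc; s≤s; _∸_) renaming (_+_ to _+ℕ_; _≤_ to _≤ℕ_; _<_ to _<ℕ_)
  import Data.Nat.Properties as NP
  open import Data.Nat.Solver using () renaming (module +-*-Solver to ℕ-Solver)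
  open import Data.Rational using (ℚ; _+_; _*_; 0ℚ; 1ℚ; -_)
  import Data.Rational.Properties as QP
  open import Data.Rational.Solver using (module +-*-Solver)
  open import Data.Sum using (inj₁; inj₂)
  open import Relation.Binary.PropositionalEquality

  altTerm : ℕ → ℕ → ℕ → ℕ → ℚ
  altTerm N M q t = sgn (N ∸ t) * ι (binom N t) * ι (binom (M +ℕ t) (q +ℕ N))

  -- (-1)^(N-u) C(N,u+1) = -(-1)^(N-u-1) C(N,u+1): the sign flips as the index moves
  -- up; for u ≥ N both sides vanish because C(N,u+1) does.
  sgn-flip : ∀ N u → sgn (N ∸ u) * ι (binom N (suc u)) ≡ - (sgn (N ∸ suc u) * ι (binom N (suc u)))
  sgn-flip N u with NP.<-≤-connex u N
  ... | inj₁ u<N = trans (cong (λ t → sgn t * ι (binom N (suc u))) (NP.+-∸-assoc 1 u<N))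
                         (sym (QP.neg-distribˡ-* (sgn (N ∸ suc u)) _))
  ... | inj₂ N≤u rewrite binom-vanish N (suc u) (s≤s N≤u) | ι-0 =
    trans (QP.*-zeroʳ (sgn (N ∸ u))) (sym (cong -_ (QP.*-zeroʳ (sgn (N ∸ suc u)))))

  -- Pascal's rule for C(N+1, t) splits each summand of the (N+1)-st sum.
  altTerm-pascal-0 : ∀ N M q → altTerm (suc N) M q 0 ≡ - altTerm N M (suc q) 0
  altTerm-pascal-0 N M q = trans (cong (λ b → - sgn N * ι 1 * ι (binom (M +ℕ 0) b)) (NP.+-suc q N))
    (solve 3 (λ s o c → (:- s) :* o :* c := :- (s :* o :* c)) refl
       (sgn N) (ι 1) (ι (binom (M +ℕ 0) (suc q +ℕ N))))
    where open +-*-Solver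

  altTerm-pascal-suc : ∀ N M q u →
    altTerm (suc N) M q (suc u) ≡ altTerm N (suc M) (suc q) u + - altTerm N M (suc q) (suc u)
  altTerm-pascal-suc N M q u = begin
      ε * ι (binom N u ℕ.+ binom N (suc u)) * ι (binom (M +ℕ suc u) (q +ℕ suc N))
    ≡⟨ cong₂ (λ z w → ε * z * ι (binom (M +ℕ suc u) w)) (ι-+ (binom N u) (binom N (suc u))) (NP.+-suc q N) ⟩
      ε * (a + b) * c
    ≡⟨ solve 4 (λ s a b c → s :* (a :+ b) :* c := s :* a :* c :+ (s :* b) :* c) refl ε a b c ⟩
      ε * a * c + (ε * b) * c
    ≡⟨ cong₂ (λ z w → ε * a * ι (binom z (suc q +ℕ N)) + w * c) (NP.+-suc M u) (sgn-flip N u) ⟩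
      ε * a * ι (binom (suc M +ℕ u) (suc q +ℕ N)) + (- (sgn (N ∸ suc u) * b)) * c
    ≡⟨ cong (ε * a * ι (binom (suc M +ℕ u) (suc q +ℕ N)) +_) (sym (QP.neg-distribˡ-* (sgn (N ∸ suc u) * b) c)) ⟩
      altTerm N (suc M) (suc q) u + - altTerm N M (suc q) (suc u) ∎
    where
    open ≡-Reasoning
    open +-*-Solver
    ε a b c : ℚ
    ε = sgn (N ∸ u)
    a = ι (binom N u)
    b = ι (binom N (suc u))
    c = ι (binom (M +ℕ suc u) (suc q +ℕ N))

  alternating-sum : ∀ N M q → Σ[≤] N (altTerm N M q) ≡ ι (binom M q)
  alternating-sum zero M q = trans (cong (_* ι (binom (M +ℕ 0) (q +ℕ 0)))
      (trans (cong (1ℚ *_) ι-1) (QP.*-identityˡ 1ℚ)))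
    (trans (QP.*-identityˡ _) (cong₂ (λ a b → ι (binom a b)) (NP.+-identityʳ M) (NP.+-identityʳ q)))
  alternating-sum (suc N) M q = begin
      Σ[≤] (suc N) (altTerm (suc N) M q)
    ≡⟨ Σ-sucˡ N (altTerm (suc N) M q) ⟩
      altTerm (suc N) M q 0 + Σ[≤] N (λ u → altTerm (suc N) M q (suc u))
    ≡⟨ cong₂ _+_ (altTerm-pascal-0 N M q)
         (trans (Σ-cong N (altTerm-pascal-suc N M q)) (Σ-+ N P (λ u → - G (suc u)))) ⟩
      - G 0 + (Σ[≤] N P + Σ[≤] N (λ u → - G (suc u)))
    ≡⟨ solve 3 (λ a b c → a :+ (b :+ c) := b :+ (a :+ c)) refl (- G 0) (Σ[≤] N P) _ ⟩
      Σ[≤] N P + (- G 0 + Σ[≤] N (λ u → - G (suc u)))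
    ≡⟨ cong (Σ[≤] N P +_) (trans (sym (Σ-sucˡ N (λ t → - G t))) (sym (Σ-neg (suc N) G))) ⟩
      Σ[≤] N P + - Σ[≤] (suc N) G
    ≡⟨ cong (λ z → Σ[≤] N P + - z) (Σ-extend N (suc N) G (NP.n≤1+n N) G-vanishes) ⟩
      Σ[≤] N P + - Σ[≤] N G
    ≡⟨ cong₂ (λ z w → z + - w) (alternating-sum N (suc M) (suc q)) (alternating-sum N M (suc q)) ⟩
      ι (binom M q ℕ.+ binom M (suc q)) + - ι (binom M (suc q))
    ≡⟨ cong (_+ - ι (binom M (suc q))) (ι-+ (binom M q) (binom M (suc q))) ⟩
      ι (binom M q) + ι (binom M (suc q)) + - ι (binom M (suc q))
    ≡⟨ solve 2 (λ a b → a :+ b :+ (:- b) := a) refl (ι (binom M q)) (ι (binom M (suc q))) ⟩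
      ι (binom M q) ∎
    where
    open ≡-Reasoning
    open +-*-Solver
    P G : ℕ → ℚ
    P = altTerm N (suc M) (suc q)
    G = altTerm N M (suc q)
    G-vanishes : ∀ k → N <ℕ k → G k ≡ 0ℚ
    G-vanishes k N<k = ι-zero-factor (sgn (N ∸ k)) (binom N k) _ (binom-vanish N k N<k)

  weight : ℕ → ℕ → ℚ
  weight n k = ι (binom n k) * ι (binom (n +ℕ k) k)

  kernel : ℕ → ℕ → ℕ → ℚ
  kernel n k j = weight n k * sgn (n ∸ k) * ι (binom k j)

  -- With n = j+N and k = j+t, trinomial revision and symmetry turn a kernel entry
  -- into C(n,j) times a summand of the alternating sum with N = n-j, M = n+j, q = j.
  kernel-as-altTerm : ∀ j t c → let N = t +ℕ c; n = j +ℕ N in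
    kernel n (j +ℕ t) j ≡ ι (binom n j) * altTerm N (n +ℕ j) j t
  kernel-as-altTerm j t c = begin
      ι (binom n (j +ℕ t)) * ι (binom (n +ℕ (j +ℕ t)) (j +ℕ t)) * sgn (n ∸ (j +ℕ t)) * ι (binom (j +ℕ t) j)
    ≡⟨ solve 4 (λ a b s d → a :* b :* s :* d := (a :* d) :* (s :* b)) refl
         (ι (binom n (j +ℕ t))) (ι (binom (n +ℕ (j +ℕ t)) (j +ℕ t))) (sgn (n ∸ (j +ℕ t))) (ι (binom (j +ℕ t) j)) ⟩
      (ι (binom n (j +ℕ t)) * ι (binom (j +ℕ t) j)) * (sgn (n ∸ (j +ℕ t)) * ι (binom (n +ℕ (j +ℕ t)) (j +ℕ t)))
    ≡⟨ cong₂ _*_ revision (cong₂ _*_ (cong sgn (NP.[m+n]∸[m+o]≡n∸o j N t)) symmetry) ⟩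
      (ι (binom n j) * ι (binom N t)) * (sgn (N ∸ t) * ι (binom (M +ℕ t) (j +ℕ N)))
    ≡⟨ solve 4 (λ a b s d → (a :* b) :* (s :* d) := a :* (s :* b :* d)) refl
         (ι (binom n j)) (ι (binom N t)) (sgn (N ∸ t)) (ι (binom (M +ℕ t) (j +ℕ N))) ⟩
      ι (binom n j) * altTerm N M j t ∎
    where
    open ≡-Reasoning
    open +-*-Solver
    N n M : ℕ
    N = t +ℕ c
    n = j +ℕ N
    M = n +ℕ j
    revision : ι (binom n (j +ℕ t)) * ι (binom (j +ℕ t) j) ≡ ι (binom n j) * ι (binom N t)
    revision = trans (sym (ι-* (binom n (j +ℕ t)) (binom (j +ℕ t) j)))
      (trans (cong ι (trans (cong (λ z → binom z (j +ℕ t) ℕ.* binom (j +ℕ t) j) (sym (NP.+-assoc j t c)))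
                            (binom-trinomial j t c)))
             (ι-* (binom n j) (binom N t)))
    symmetry : ι (binom (n +ℕ (j +ℕ t)) (j +ℕ t)) ≡ ι (binom (M +ℕ t) (j +ℕ N))
    symmetry = cong ι (trans (cong (λ z → binom z (j +ℕ t)) (NP.+-comm n (j +ℕ t)))
      (trans (binom-sym (j +ℕ t) n)
             (cong (λ z → binom z n)
                (ℕ-Solver.solve 3 (λ j t n → (j ℕ-Solver.:+ t) ℕ-Solver.:+ n ℕ-Solver.:= (n ℕ-Solver.:+ j) ℕ-Solver.:+ t)
                   refl j t n))))

  kernel-column : ∀ n j → j ≤ℕ n → Σ[≤] n (λ k → kernel n k j) ≡ weight n j
  kernel-column n j j≤n =
    subst (λ n′ → Σ[≤] n′ (λ k → kernel n′ k j) ≡ weight n′ j) (NP.m+[n∸m]≡n j≤n) (column j (n ∸ j))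
    where
    open ≡-Reasoning
    column : ∀ j N → Σ[≤] (j +ℕ N) (λ k → kernel (j +ℕ N) k j) ≡ weight (j +ℕ N) j
    column j N = begin
        Σ[≤] (j +ℕ N) (λ k → kernel (j +ℕ N) k j)
      ≡⟨ Σ-shift j N (λ k → kernel (j +ℕ N) k j)
           (λ k k<j → trans (cong (λ z → kernel′ k * ι z) (binom-vanish k j k<j))
                            (trans (cong (kernel′ k *_) ι-0) (QP.*-zeroʳ (kernel′ k)))) ⟩
        Σ[≤] N (λ t → kernel (j +ℕ N) (j +ℕ t) j)
      ≡⟨ Σ-cong-≤ N (λ t t≤N → subst (λ N′ → kernel (j +ℕ N′) (j +ℕ t) j ≡ ι (binom (j +ℕ N′) j) * altTerm N′ ((j +ℕ N′) +ℕ j) j t)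
                                      (NP.m+[n∸m]≡n t≤N) (kernel-as-altTerm j t (N ∸ t))) ⟩
        Σ[≤] N (λ t → ι (binom (j +ℕ N) j) * altTerm N ((j +ℕ N) +ℕ j) j t)
      ≡⟨ sym (Σ-*ˡ N (ι (binom (j +ℕ N) j)) (altTerm N ((j +ℕ N) +ℕ j) j)) ⟩
        ι (binom (j +ℕ N) j) * Σ[≤] N (altTerm N ((j +ℕ N) +ℕ j) j)
      ≡⟨ cong (ι (binom (j +ℕ N) j) *_) (alternating-sum N ((j +ℕ N) +ℕ j) j) ⟩
        weight (j +ℕ N) j ∎
      where
      kernel′ : ℕ → ℚ
      kernel′ k = weight (j +ℕ N) k * sgn ((j +ℕ N) ∸ k)

  inversion : ∀ n (b : ℕ → ℚ) →
    Σ[≤] n (λ k → weight n k * b k) ≡ Σ[≤] n (λ k → weight n k * sgn (n ∸ k) * Σ[≤] k (λ i → ι (binom k i) * b i))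
  inversion n b = sym (begin
      Σ[≤] n (λ k → weight n k * sgn (n ∸ k) * Σ[≤] k (λ i → ι (binom k i) * b i))
    ≡⟨ Σ-cong-≤ n (λ k k≤n → cong (weight n k * sgn (n ∸ k) *_) (sym (Σ-extend k n (λ i → ι (binom k i) * b i) k≤n
         (λ i k<i → trans (cong (_* b i) (trans (cong ι (binom-vanish k i k<i)) ι-0)) (QP.*-zeroˡ (b i)))))) ⟩
      Σ[≤] n (λ k → weight n k * sgn (n ∸ k) * Σ[≤] n (λ i → ι (binom k i) * b i))
    ≡⟨ Σ-cong n (λ k → trans (Σ-*ˡ n (weight n k * sgn (n ∸ k)) (λ i → ι (binom k i) * b i))
         (Σ-cong n (λ i → solve 4 (λ x s y z → x :* s :* (y :* z) := x :* s :* y :* z) refl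
                            (weight n k) (sgn (n ∸ k)) (ι (binom k i)) (b i)))) ⟩
      Σ[≤] n (λ k → Σ[≤] n (λ i → kernel n k i * b i))
    ≡⟨ Σ-swap n n (λ k i → kernel n k i * b i) ⟩
      Σ[≤] n (λ i → Σ[≤] n (λ k → kernel n k i * b i))
    ≡⟨ Σ-cong n (λ i → Σ-*ʳ n (λ k → kernel n k i) (b i)) ⟩
      Σ[≤] n (λ i → Σ[≤] n (λ k → kernel n k i) * b i)
    ≡⟨ Σ-cong-≤ n (λ i i≤n → cong (_* b i) (kernel-column n i i≤n)) ⟩
      Σ[≤] n (λ k → weight n k * b k) ∎)
    where
    open ≡-Reasoning
    open +-*-Solver

module BinomialTransform where

  open FiniteSums
  open Binomial
  open Embedding
  open import Data.Nat as ℕ using (ℕ; zero; suc; s≤s; _∸_) renaming (_+_ to _+ℕ_; _≤_ to _≤ℕ_)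
  import Data.Nat.Properties as NP
  open import Data.Rational using (ℚ; _+_; _*_; 0ℚ; 1ℚ)
  import Data.Rational.Properties as QP
  open import Data.Rational.Solver using (module +-*-Solver)
  open import Data.Sum using (inj₁; inj₂)
  open import Relation.Binary.PropositionalEquality

  -- The binomial transform with parameter a:  BT g a k = Σ_{i≤k} C(k,i) a^(k-i) g_i,
  -- i.e. the umbral expansion of (a + g)^k.
  BT : (ℕ → ℚ) → ℚ → ℕ → ℚ
  BT g a k = Σ[≤] k (λ i → ι (binom k i) * a ^ (k ∸ i) * g i)

  BT-cong : ∀ {f g} a k → (∀ i → f i ≡ g i) → BT f a k ≡ BT g a k
  BT-cong a k e = Σ-cong k (λ i → cong (ι (binom k i) * a ^ (k ∸ i) *_) (e i))

  BT-linear : ∀ c f h a k → BT (λ i → c * f i + h i) a k ≡ c * BT f a k + BT h a k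
  BT-linear c f h a k = trans
    (Σ-cong k (λ i → solve 5 (λ x p c f h → x :* p :* (c :* f :+ h) := c :* (x :* p :* f) :+ x :* p :* h) refl
                        (ι (binom k i)) (a ^ (k ∸ i)) c (f i) (h i)))
    (trans (Σ-+ k _ _) (cong (_+ BT h a k) (sym (Σ-*ˡ k c (λ i → ι (binom k i) * a ^ (k ∸ i) * f i)))))
    where open +-*-Solver

  BT-scale : ∀ c f a k → BT (λ i → c * f i) a k ≡ c * BT f a k
  BT-scale c f a k = trans
    (Σ-cong k (λ i → solve 4 (λ x p c f → x :* p :* (c :* f) := c :* (x :* p :* f)) refl
                        (ι (binom k i)) (a ^ (k ∸ i)) c (f i)))
    (sym (Σ-*ˡ k c (λ i → ι (binom k i) * a ^ (k ∸ i) * f i)))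
    where open +-*-Solver

  BT-null : ∀ f a k → (∀ i → f i ≡ 0ℚ) → BT f a k ≡ 0ℚ
  BT-null f a k e = Σ-zero k _ (λ i → trans (cong (ι (binom k i) * a ^ (k ∸ i) *_) (e i))
                                            (QP.*-zeroʳ (ι (binom k i) * a ^ (k ∸ i))))

  BT-0 : ∀ g a → BT g a 0 ≡ g 0
  BT-0 g a = trans (cong (λ z → z * 1ℚ * g 0) ι-1)
    (trans (cong (_* g 0) (QP.*-identityˡ 1ℚ)) (QP.*-identityˡ (g 0)))

  -- Multiplying a term C(k,i+1) a^(k-i-1) c by a raises the power to k-i; when
  -- i+1 > k both sides vanish.
  absorb-power : ∀ a k u c →
    a * (ι (binom k (suc u)) * a ^ (k ∸ suc u) * c) ≡ ι (binom k (suc u)) * a ^ (k ∸ u) * c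
  absorb-power a k u c with NP.<-≤-connex u k
  ... | inj₁ u<k = trans
    (solve 4 (λ a x p h → a :* (x :* p :* h) := x :* (a :* p) :* h) refl a (ι (binom k (suc u))) (a ^ (k ∸ suc u)) c)
    (cong (λ z → ι (binom k (suc u)) * a ^ z * c) (sym (NP.+-∸-assoc 1 u<k)))
    where open +-*-Solver
  ... | inj₂ k≤u rewrite binom-vanish k (suc u) (s≤s k≤u) | ι-0 =
    trans (solve 3 (λ a p h → a :* (con 0ℚ :* p :* h) := con 0ℚ) refl a (a ^ (k ∸ suc u)) c)
          (sym (solve 2 (λ p h → con 0ℚ :* p :* h := con 0ℚ) refl (a ^ (k ∸ u)) c))
    where open +-*-Solver

  BT-*-parameter : ∀ g a k →
    a * BT g a k ≡ ι 1 * a ^ suc k * g 0 + Σ[≤] k (λ u → ι (binom k (suc u)) * a ^ (k ∸ u) * g (suc u))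
  BT-*-parameter g a k = begin
      a * BT g a k
    ≡⟨ Σ-*ˡ k a _ ⟩
      Σ[≤] k h
    ≡⟨ sym (Σ-extend k (suc k) h (NP.n≤1+n k) (λ i k<i → trans
         (cong (λ z → a * (z * a ^ (k ∸ i) * g i)) (trans (cong ι (binom-vanish k i k<i)) ι-0))
         (solve 3 (λ a p h → a :* (con 0ℚ :* p :* h) := con 0ℚ) refl a (a ^ (k ∸ i)) (g i)))) ⟩
      Σ[≤] (suc k) h
    ≡⟨ Σ-sucˡ k h ⟩
      h 0 + Σ[≤] k (λ u → h (suc u))
    ≡⟨ cong₂ _+_ (solve 4 (λ a o p h → a :* (o :* p :* h) := o :* (a :* p) :* h) refl a (ι 1) (a ^ k) (g 0))
                 (Σ-cong k (λ u → absorb-power a k u (g (suc u)))) ⟩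
      ι 1 * a ^ suc k * g 0 + Σ[≤] k (λ u → ι (binom k (suc u)) * a ^ (k ∸ u) * g (suc u)) ∎
    where
    open ≡-Reasoning
    open +-*-Solver
    h : ℕ → ℚ
    h i = a * (ι (binom k i) * a ^ (k ∸ i) * g i)

  BT-suc : ∀ g a k → BT g a (suc k) ≡ a * BT g a k + BT (λ i → g (suc i)) a k
  BT-suc g a k = begin
      BT g a (suc k)
    ≡⟨ Σ-sucˡ k _ ⟩
      t₀ + Σ[≤] k (λ u → ι (binom k u ℕ.+ binom k (suc u)) * a ^ (k ∸ u) * g (suc u))
    ≡⟨ cong (t₀ +_) (trans (Σ-cong k pascal) (Σ-+ k _ _)) ⟩
      t₀ + (BT (λ i → g (suc i)) a k + rest)
    ≡⟨ solve 3 (λ p q r → p :+ (q :+ r) := (p :+ r) :+ q) refl t₀ (BT (λ i → g (suc i)) a k) rest ⟩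
      (t₀ + rest) + BT (λ i → g (suc i)) a k
    ≡⟨ cong (_+ BT (λ i → g (suc i)) a k) (sym (BT-*-parameter g a k)) ⟩
      a * BT g a k + BT (λ i → g (suc i)) a k ∎
    where
    open ≡-Reasoning
    open +-*-Solver
    t₀ rest : ℚ
    t₀ = ι 1 * a ^ suc k * g 0
    rest = Σ[≤] k (λ u → ι (binom k (suc u)) * a ^ (k ∸ u) * g (suc u))
    pascal : ∀ u → ι (binom k u ℕ.+ binom k (suc u)) * a ^ (k ∸ u) * g (suc u)
                 ≡ ι (binom k u) * a ^ (k ∸ u) * g (suc u) + ι (binom k (suc u)) * a ^ (k ∸ u) * g (suc u)
    pascal u = trans (cong (λ z → z * a ^ (k ∸ u) * g (suc u)) (ι-+ (binom k u) (binom k (suc u))))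
      (solve 4 (λ x y p h → (x :+ y) :* p :* h := x :* p :* h :+ y :* p :* h) refl
         (ι (binom k u)) (ι (binom k (suc u))) (a ^ (k ∸ u)) (g (suc u)))

  BT-compose : ∀ g a b k → BT (λ i → BT g b i) a k ≡ BT g (a + b) k
  BT-compose g a b zero = trans (BT-0 (λ i → BT g b i) a) (trans (BT-0 g b) (sym (BT-0 g (a + b))))
  BT-compose g a b (suc k) = begin
      BT h a (suc k)
    ≡⟨ BT-suc h a k ⟩
      a * BT h a k + BT (λ i → h (suc i)) a k
    ≡⟨ cong (a * BT h a k +_) (trans (BT-cong a k (λ i → BT-suc g b i)) (BT-linear b h (λ i → BT g′ b i) a k)) ⟩
      a * BT h a k + (b * BT h a k + BT (λ i → BT g′ b i) a k)
    ≡⟨ cong₂ (λ X Y → a * X + (b * X + Y)) (BT-compose g a b k) (BT-compose g′ a b k) ⟩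
      a * BT g (a + b) k + (b * BT g (a + b) k + BT g′ (a + b) k)
    ≡⟨ solve 4 (λ a b X Y → a :* X :+ (b :* X :+ Y) := (a :+ b) :* X :+ Y) refl a b (BT g (a + b) k) (BT g′ (a + b) k) ⟩
      (a + b) * BT g (a + b) k + BT g′ (a + b) k
    ≡⟨ sym (BT-suc g (a + b) k) ⟩
      BT g (a + b) (suc k) ∎
    where
    open ≡-Reasoning
    open +-*-Solver
    h g′ : ℕ → ℚ
    h i = BT g b i
    g′ i = g (suc i)

  BT-at-0 : ∀ g k → BT g 0ℚ k ≡ g k
  BT-at-0 g zero    = BT-0 g 0ℚ
  BT-at-0 g (suc k) = trans (BT-suc g 0ℚ k)
    (trans (cong (_+ BT (λ i → g (suc i)) 0ℚ k) (QP.*-zeroˡ (BT g 0ℚ k)))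
    (trans (QP.+-identityˡ _) (BT-at-0 (λ i → g (suc i)) k)))

  BT-rescale : ∀ p q → p * q ≡ 1ℚ → ∀ g k → q ^ k * BT g p k ≡ Σ[≤] k (λ i → ι (binom k i) * (q ^ i * g i))
  BT-rescale p q pq≡1 g k = trans (Σ-*ˡ k (q ^ k) _) (Σ-cong-≤ k term)
    where
    open +-*-Solver
    term : ∀ i → i ≤ℕ k → q ^ k * (ι (binom k i) * p ^ (k ∸ i) * g i) ≡ ι (binom k i) * (q ^ i * g i)
    term i i≤k = trans
      (solve 4 (λ Q x P y → Q :* (x :* P :* y) := x :* ((Q :* P) :* y)) refl (q ^ k) (ι (binom k i)) (p ^ (k ∸ i)) (g i))
      (cong (λ z → ι (binom k i) * (z * g i))
        (subst (λ k′ → q ^ k′ * p ^ (k′ ∸ i) ≡ q ^ i) (NP.m+[n∸m]≡n i≤k)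
          (trans (cong (λ z → q ^ (i +ℕ (k ∸ i)) * p ^ z) (NP.m+n∸m≡n i (k ∸ i))) (^-cancel p q pq≡1 i (k ∸ i)))))

module StirlingBell where

  open FiniteSums
  open Binomial
  open Embedding
  open BinomialTransform
  open import Data.Nat as ℕ using (ℕ; zero; suc; s≤s; _∸_) renaming (_+_ to _+ℕ_; _<_ to _<ℕ_)
  import Data.Nat.Properties as NP
  import Data.Integer as ℤ
  import Data.Integer.Properties as ZP
  open import Data.Rational using (ℚ; _+_; _*_; 0ℚ; 1ℚ; -_)
  import Data.Rational.Properties as QP
  open import Data.Rational.Solver using (module +-*-Solver)
  open import Relation.Binary.PropositionalEquality

  S-vanish : ∀ n l → n <ℕ l → S n l ≡ 0
  S-vanish zero    (suc l) _         = refl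
  S-vanish (suc n) (suc l) (s≤s n<l) = cong₂ ℕ._+_
    (trans (cong (suc l ℕ.*_) (S-vanish n (suc l) (NP.m<n⇒m<1+n n<l))) (NP.*-zeroʳ (suc l)))
    (S-vanish n l n<l)

  s-vanish : ∀ r j → r <ℕ j → s r j ≡ ℤ.+ 0
  s-vanish zero    (suc j) _ = refl
  s-vanish (suc r) (suc j) (s≤s r<j)
    rewrite s-vanish r j r<j | s-vanish r (suc j) (NP.m<n⇒m<1+n r<j) | ZP.*-zeroʳ (ℤ.+ r) = refl

  S-column : ℕ → ℕ → ℚ
  S-column l i = ι (S i l)

  φ-via-ι : ∀ n x → φ n x ≡ Σ[≤] n (λ l → ι (S n l) * x ^ l)
  φ-via-ι n x = Σ-cong n (λ l → cong (_* x ^ l) (sym (ι≡ℕ→ℚ (S n l))))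

  S-binomial : ∀ n l → ι (S (suc n) (suc l)) ≡ BT (S-column l) 1ℚ n
  S-binomial zero l = trans (cong ι (cong (ℕ._+ S 0 l) (NP.*-zeroʳ (suc l)))) (sym (BT-0 (S-column l) 1ℚ))
  S-binomial (suc n) zero = begin
      ι (1 ℕ.* S (suc n) 1 ℕ.+ 0)
    ≡⟨ cong ι (trans (NP.+-identityʳ _) (NP.*-identityˡ _)) ⟩
      ι (S (suc n) 1)
    ≡⟨ S-binomial n zero ⟩
      BT (S-column 0) 1ℚ n
    ≡⟨ sym (trans (cong₂ _+_ (QP.*-identityˡ (BT (S-column 0) 1ℚ n)) (BT-null (λ i → S-column 0 (suc i)) 1ℚ n (λ i → ι-0)))
                  (QP.+-identityʳ _)) ⟩
      1ℚ * BT (S-column 0) 1ℚ n + BT (λ i → S-column 0 (suc i)) 1ℚ n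
    ≡⟨ sym (BT-suc (S-column 0) 1ℚ n) ⟩
      BT (S-column 0) 1ℚ (suc n) ∎
    where open ≡-Reasoning
  S-binomial (suc n) (suc l) = begin
      ι (suc (suc l) ℕ.* S (suc n) (suc (suc l)) ℕ.+ S (suc n) (suc l))
    ≡⟨ trans (ι-+ _ _) (cong (_+ ι (S (suc n) (suc l))) (ι-* (suc (suc l)) _)) ⟩
      ι (suc (suc l)) * ι (S (suc n) (suc (suc l))) + ι (S (suc n) (suc l))
    ≡⟨ cong₂ (λ X Y → ι (suc (suc l)) * X + Y) (S-binomial n (suc l)) (S-binomial n l) ⟩
      ι (suc (suc l)) * X + Y
    ≡⟨ cong (λ z → z * X + Y) (ι-suc (suc l)) ⟩
      (1ℚ + ι (suc l)) * X + Y
    ≡⟨ solve 3 (λ c X Y → (con 1ℚ :+ c) :* X :+ Y := con 1ℚ :* X :+ (c :* X :+ Y)) refl (ι (suc l)) X Y ⟩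
      1ℚ * X + (ι (suc l) * X + Y)
    ≡⟨ cong (1ℚ * X +_) (sym (trans
         (BT-cong 1ℚ n (λ i → trans (ι-+ _ _) (cong (_+ ι (S i l)) (ι-* (suc l) (S i (suc l))))))
         (BT-linear (ι (suc l)) (S-column (suc l)) (S-column l) 1ℚ n))) ⟩
      1ℚ * X + BT (λ i → S-column (suc l) (suc i)) 1ℚ n
    ≡⟨ sym (BT-suc (S-column (suc l)) 1ℚ n) ⟩
      BT (S-column (suc l)) 1ℚ (suc n) ∎
    where
    open ≡-Reasoning
    open +-*-Solver
    X Y : ℚ
    X = BT (S-column (suc l)) 1ℚ n
    Y = BT (S-column l) 1ℚ n

  Σ-S-columns : ∀ n x → Σ[≤] n (λ l → BT (S-column l) 1ℚ n * x ^ l) ≡ BT (λ i → φ i x) 1ℚ n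
  Σ-S-columns n x = begin
      Σ[≤] n (λ l → BT (S-column l) 1ℚ n * x ^ l)
    ≡⟨ Σ-cong n (λ l → trans (sym (Σ-*ʳ n _ (x ^ l))) (Σ-cong n (λ i →
         solve 4 (λ a b c p → a :* b :* c :* p := a :* b :* (c :* p)) refl (ι (binom n i)) (1ℚ ^ (n ∸ i)) (ι (S i l)) (x ^ l)))) ⟩
      Σ[≤] n (λ l → Σ[≤] n (λ i → c i * (ι (S i l) * x ^ l)))
    ≡⟨ Σ-swap n n _ ⟩
      Σ[≤] n (λ i → Σ[≤] n (λ l → c i * (ι (S i l) * x ^ l)))
    ≡⟨ Σ-cong n (λ i → sym (Σ-*ˡ n (c i) _)) ⟩
      Σ[≤] n (λ i → c i * Σ[≤] n (λ l → ι (S i l) * x ^ l))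
    ≡⟨ Σ-cong-≤ n (λ i i≤n → cong (c i *_)
         (trans (Σ-extend i n _ i≤n (λ l i<l → trans (cong (_* x ^ l) (trans (cong ι (S-vanish i l i<l)) ι-0))
                                                      (QP.*-zeroˡ (x ^ l))))
                (sym (φ-via-ι i x)))) ⟩
      BT (λ i → φ i x) 1ℚ n ∎
    where
    open ≡-Reasoning
    open +-*-Solver
    c : ℕ → ℚ
    c i = ι (binom n i) * 1ℚ ^ (n ∸ i)

  bell-recurrence : ∀ n x → φ (suc n) x ≡ x * BT (λ i → φ i x) 1ℚ n
  bell-recurrence n x = begin
      φ (suc n) x
    ≡⟨ trans (φ-via-ι (suc n) x) (Σ-sucˡ n _) ⟩
      ι (S (suc n) 0) * 1ℚ + Σ[≤] n (λ l → ι (S (suc n) (suc l)) * (x * x ^ l))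
    ≡⟨ cong₂ _+_ (trans (cong (_* 1ℚ) ι-0) (QP.*-zeroˡ 1ℚ)) (Σ-cong n (λ l → trans (cong (_* (x * x ^ l)) (S-binomial n l))
         (solve 3 (λ b x p → b :* (x :* p) := x :* (b :* p)) refl (BT (S-column l) 1ℚ n) x (x ^ l)))) ⟩
      0ℚ + Σ[≤] n (λ l → x * (BT (S-column l) 1ℚ n * x ^ l))
    ≡⟨ trans (QP.+-identityˡ _) (sym (Σ-*ˡ n x _)) ⟩
      x * Σ[≤] n (λ l → BT (S-column l) 1ℚ n * x ^ l)
    ≡⟨ cong (x *_) (Σ-S-columns n x) ⟩
      x * BT (λ i → φ i x) 1ℚ n ∎
    where
    open ≡-Reasoning
    open +-*-Solver

  -- The Bell sum Σ_{j≤r} s(r,j) φ_{k+j}(x), i.e. the umbral image of x^k (x)_r.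
  fallingBell : ℚ → ℕ → ℕ → ℚ
  fallingBell x r k = Σ[≤] r (λ j → ℤ→ℚ (s r j) * φ (k +ℕ j) x)

  ι-*-s-r-0 : ∀ r (c : ℚ) → ι r * (ℤ→ℚ (s r 0) * c) ≡ 0ℚ
  ι-*-s-r-0 zero    c = trans (cong (_* (ℤ→ℚ (s 0 0) * c)) ι-0) (QP.*-zeroˡ (ℤ→ℚ (s 0 0) * c))
  ι-*-s-r-0 (suc r) c = trans (cong (ι (suc r) *_) (QP.*-zeroˡ c)) (QP.*-zeroʳ (ι (suc r)))

  fallingBell-suc : ∀ x r k → fallingBell x (suc r) k ≡ fallingBell x r (suc k) + - (ι r * fallingBell x r k)
  fallingBell-suc x r k = begin
      fallingBell x (suc r) k
    ≡⟨ Σ-sucˡ r _ ⟩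
      ℤ→ℚ (ℤ.+ 0) * φ (k +ℕ 0) x + Σ[≤] r (λ j → ℤ→ℚ (s r j ℤ.- ℤ.+ r ℤ.* s r (suc j)) * φ (k +ℕ suc j) x)
    ≡⟨ trans (cong (_+ Σ[≤] r recurrence) (QP.*-zeroˡ (φ (k +ℕ 0) x))) (QP.+-identityˡ _) ⟩
      Σ[≤] r recurrence
    ≡⟨ Σ-cong r split ⟩
      Σ[≤] r (λ j → ℤ→ℚ (s r j) * φ (suc k +ℕ j) x + - (ι r * f (suc j)))
    ≡⟨ trans (Σ-+ r _ _) (cong (fallingBell x r (suc k) +_) (trans (sym (Σ-neg r _)) (cong -_ (sym (Σ-*ˡ r (ι r) _))))) ⟩
      fallingBell x r (suc k) + - (ι r * Σ[≤] r (λ j → f (suc j)))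
    ≡⟨ cong (λ z → fallingBell x r (suc k) + - z) (sym shifted) ⟩
      fallingBell x r (suc k) + - (ι r * fallingBell x r k) ∎
    where
    open ≡-Reasoning
    open +-*-Solver
    f recurrence : ℕ → ℚ
    f j = ℤ→ℚ (s r j) * φ (k +ℕ j) x
    recurrence j = ℤ→ℚ (s r j ℤ.- ℤ.+ r ℤ.* s r (suc j)) * φ (k +ℕ suc j) x
    split : ∀ j → recurrence j ≡ ℤ→ℚ (s r j) * φ (suc k +ℕ j) x + - (ι r * f (suc j))
    split j = begin
        ℤ→ℚ (s r j ℤ.- ℤ.+ r ℤ.* s r (suc j)) * φ (k +ℕ suc j) x
      ≡⟨ cong (_* φ (k +ℕ suc j) x) (trans (ℤ→ℚ-- (s r j) _)
           (cong (λ z → ℤ→ℚ (s r j) + - z) (trans (ℤ→ℚ-* (ℤ.+ r) (s r (suc j))) (cong (_* ℤ→ℚ (s r (suc j))) (sym (ι≡ℕ→ℚ r)))))) ⟩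
        (ℤ→ℚ (s r j) + - (ι r * ℤ→ℚ (s r (suc j)))) * φ (k +ℕ suc j) x
      ≡⟨ solve 4 (λ a c b p → (a :+ :- (c :* b)) :* p := a :* p :+ :- (c :* (b :* p))) refl
           (ℤ→ℚ (s r j)) (ι r) (ℤ→ℚ (s r (suc j))) (φ (k +ℕ suc j) x) ⟩
        ℤ→ℚ (s r j) * φ (k +ℕ suc j) x + - (ι r * f (suc j))
      ≡⟨ cong (λ z → ℤ→ℚ (s r j) * φ z x + - (ι r * f (suc j))) (NP.+-suc k j) ⟩
        ℤ→ℚ (s r j) * φ (suc k +ℕ j) x + - (ι r * f (suc j)) ∎
    -- The j = 0 term of r · fallingBell x r k vanishes, and so does the (r+1)-st.
    shifted : ι r * fallingBell x r k ≡ ι r * Σ[≤] r (λ j → f (suc j))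
    shifted = begin
        ι r * fallingBell x r k
      ≡⟨ cong (ι r *_) (trans (sym (Σ-extend r (suc r) f (NP.n≤1+n r)
           (λ j r<j → trans (cong (λ z → ℤ→ℚ z * φ (k +ℕ j) x) (s-vanish r j r<j)) (QP.*-zeroˡ (φ (k +ℕ j) x)))))
           (Σ-sucˡ r f)) ⟩
        ι r * (f 0 + Σ[≤] r (λ j → f (suc j)))
      ≡⟨ QP.*-distribˡ-+ (ι r) (f 0) _ ⟩
        ι r * f 0 + ι r * Σ[≤] r (λ j → f (suc j))
      ≡⟨ trans (cong (_+ ι r * Σ[≤] r (λ j → f (suc j))) (ι-*-s-r-0 r (φ (k +ℕ 0) x))) (QP.+-identityˡ _) ⟩
        ι r * Σ[≤] r (λ j → f (suc j)) ∎

  fallingBell-closed : ∀ x r k → fallingBell x r k ≡ x ^ r * BT (λ i → φ i x) (ι r) k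
  fallingBell-closed x zero k = trans (trans (QP.*-identityˡ _) (cong (λ z → φ z x) (NP.+-identityʳ k)))
    (sym (trans (QP.*-identityˡ _) (trans (cong (λ a → BT (λ i → φ i x) a k) ι-0) (BT-at-0 (λ i → φ i x) k))))
  fallingBell-closed x (suc r) k = begin
      fallingBell x (suc r) k
    ≡⟨ fallingBell-suc x r k ⟩
      fallingBell x r (suc k) + - (ι r * fallingBell x r k)
    ≡⟨ cong₂ (λ a b → a + - (ι r * b)) (trans (fallingBell-closed x r (suc k)) (cong (x ^ r *_) (BT-suc Φ (ι r) k)))
                                      (fallingBell-closed x r k) ⟩
      x ^ r * (ι r * BT Φ (ι r) k + BT Φ′ (ι r) k) + - (ι r * (x ^ r * BT Φ (ι r) k))
    ≡⟨ solve 4 (λ p c X Y → p :* (c :* X :+ Y) :+ :- (c :* (p :* X)) := p :* Y) refl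
         (x ^ r) (ι r) (BT Φ (ι r) k) (BT Φ′ (ι r) k) ⟩
      x ^ r * BT Φ′ (ι r) k
    ≡⟨ cong (x ^ r *_) (trans (BT-cong (ι r) k (λ i → bell-recurrence i x)) (BT-scale x (λ i → BT Φ 1ℚ i) (ι r) k)) ⟩
      x ^ r * (x * BT (λ i → BT Φ 1ℚ i) (ι r) k)
    ≡⟨ cong (λ z → x ^ r * (x * z)) (BT-compose Φ (ι r) 1ℚ k) ⟩
      x ^ r * (x * BT Φ (ι r + 1ℚ) k)
    ≡⟨ cong (λ a → x ^ r * (x * BT Φ a k)) (sym (trans (cong ι (NP.+-comm 1 r)) (trans (ι-+ r 1) (cong (ι r +_) ι-1)))) ⟩
      x ^ r * (x * BT Φ (ι (suc r)) k)
    ≡⟨ solve 3 (λ p x y → p :* (x :* y) := x :* p :* y) refl (x ^ r) x (BT Φ (ι (suc r)) k) ⟩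
      x ^ suc r * BT Φ (ι (suc r)) k ∎
    where
    open ≡-Reasoning
    open +-*-Solver
    Φ Φ′ : ℕ → ℚ
    Φ i = φ i x
    Φ′ i = φ (suc i) x

module Dowling where

  open FiniteSums
  open Binomial
  open Embedding
  open BinomialTransform
  open StirlingBell
  open import Data.Nat as ℕ using (ℕ; zero; suc; _∸_; _≤ᵇ_) renaming (_+_ to _+ℕ_; _≤_ to _≤ℕ_)
  import Data.Nat.Properties as NP
  open import Data.Nat.Combinatorics using (_C_)
  open import Data.Bool using (true; false; if_then_else_)
  open import Data.Rational using (ℚ; _+_; _*_; 0ℚ; 1ℚ)
  import Data.Rational.Properties as QP
  open import Data.Rational.Solver using (module +-*-Solver)
  open import Relation.Nullary.Reflects using (ofʸ; ofⁿ)
  open import Relation.Binary.PropositionalEquality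

  ι-if : ∀ b a → ι (if b then a else 0) ≡ (if b then ι a else 0ℚ)
  ι-if true  a = refl
  ι-if false a = ι-0

  ι-Σ-from : ∀ l k f → ι (Σ[from l to k ] f) ≡ Σ[≤] k (λ j → if l ≤ᵇ j then ι (f j) else 0ℚ)
  ι-Σ-from l zero    f = ι-if (l ≤ᵇ 0) (f 0)
  ι-Σ-from l (suc k) f = trans (ι-+ _ _) (cong₂ _+_ (ι-Σ-from l k f) (ι-if (l ≤ᵇ suc k) (f (suc k))))

  module _ (m r : ℕ) (μ : ℚ) (mμ≡1 : ι m * μ ≡ 1ℚ) (x : ℚ) where
    open +-*-Solver

    whitneyTerm : ℕ → ℕ → ℕ → ℕ
    whitneyTerm k l j = (k C j) ℕ.* (m ℕ.^ (j ∸ l)) ℕ.* (r ℕ.^ (k ∸ j)) ℕ.* S j l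

    -- Each term of the double sum for D_{m,r}(k,x), written as
    -- C(k,j) r^(k-j) · m^j S(j,l) (x/m)^l; both sides vanish when l > j.
    whitneyTerm-rescaled : ∀ k j l →
      (if l ≤ᵇ j then ι (whitneyTerm k l j) else 0ℚ) * x ^ l
        ≡ ι (binom k j) * ι r ^ (k ∸ j) * (ι m ^ j * (ι (S j l) * (x * μ) ^ l))
    whitneyTerm-rescaled k j l with l ≤ᵇ j | NP.≤ᵇ-reflects-≤ l j
    ... | true  | ofʸ l≤j = begin
        ι ((k C j) ℕ.* m ℕ.^ (j ∸ l) ℕ.* r ℕ.^ (k ∸ j) ℕ.* S j l) * x ^ l
      ≡⟨ cong (_* x ^ l) (trans (ι-* _ _) (cong (_* ι (S j l)) (trans (ι-* _ _)
           (cong₂ _*_ (trans (ι-* _ _) (cong₂ _*_ (cong ι (C≡binom k j)) (ι-^ m (j ∸ l)))) (ι-^ r (k ∸ j)))))) ⟩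
        c * ι m ^ (j ∸ l) * ρ * σ * x ^ l
      ≡⟨ cong (λ z → c * z * ρ * σ * x ^ l) (sym (^-cancel μ (ι m) (trans (QP.*-comm μ (ι m)) mμ≡1) (j ∸ l) l)) ⟩
        c * (ι m ^ ((j ∸ l) +ℕ l) * μ ^ l) * ρ * σ * x ^ l
      ≡⟨ cong (λ z → c * (ι m ^ z * μ ^ l) * ρ * σ * x ^ l) (NP.m∸n+n≡m l≤j) ⟩
        c * (ι m ^ j * μ ^ l) * ρ * σ * x ^ l
      ≡⟨ solve 6 (λ b mj ml rr s xl → b :* (mj :* ml) :* rr :* s :* xl := b :* rr :* (mj :* (s :* (xl :* ml)))) refl
           c (ι m ^ j) (μ ^ l) ρ σ (x ^ l) ⟩
        c * ρ * (ι m ^ j * (σ * (x ^ l * μ ^ l)))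
      ≡⟨ cong (λ z → c * ρ * (ι m ^ j * (σ * z))) (sym (^-distrib-* x μ l)) ⟩
        c * ρ * (ι m ^ j * (σ * (x * μ) ^ l)) ∎
      where
      open ≡-Reasoning
      c ρ σ : ℚ
      c = ι (binom k j)
      ρ = ι r ^ (k ∸ j)
      σ = ι (S j l)
    ... | false | ofⁿ l≰j rewrite S-vanish j l (NP.≰⇒> l≰j) | ι-0 = trans (QP.*-zeroˡ (x ^ l))
      (sym (solve 4 (λ b rr mj p → b :* rr :* (mj :* (con 0ℚ :* p)) := con 0ℚ) refl
              (ι (binom k j)) (ι r ^ (k ∸ j)) (ι m ^ j) ((x * μ) ^ l)))

    bell-inner : ∀ k j → j ≤ℕ k → (c : ℚ) →
      Σ[≤] k (λ l → c * (ι m ^ j * (ι (S j l) * (x * μ) ^ l))) ≡ c * (ι m ^ j * φ j (x * μ))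
    bell-inner k j j≤k c = trans (sym (Σ-*ˡ k c _)) (cong (c *_) (trans (sym (Σ-*ˡ k (ι m ^ j) _))
      (cong (ι m ^ j *_) (trans (Σ-extend j k _ j≤k vanish) (sym (φ-via-ι j (x * μ)))))))
      where
      vanish : ∀ l → j ℕ.< l → ι (S j l) * (x * μ) ^ l ≡ 0ℚ
      vanish l j<l = trans (cong (_* (x * μ) ^ l) (trans (cong ι (S-vanish j l j<l)) ι-0)) (QP.*-zeroˡ ((x * μ) ^ l))

    dowling-as-transform : ∀ k → D m r k x ≡ BT (λ i → ι m ^ i * φ i (x * μ)) (ι r) k
    dowling-as-transform k = begin
        D m r k x
      ≡⟨ Σ-cong k (λ l → cong (_* x ^ l) (trans (sym (ι≡ℕ→ℚ (W m r k l))) (ι-Σ-from l k (whitneyTerm k l)))) ⟩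
        Σ[≤] k (λ l → Σ[≤] k (λ j → if l ≤ᵇ j then ι (whitneyTerm k l j) else 0ℚ) * x ^ l)
      ≡⟨ Σ-cong k (λ l → sym (Σ-*ʳ k _ (x ^ l))) ⟩
        Σ[≤] k (λ l → Σ[≤] k (λ j → (if l ≤ᵇ j then ι (whitneyTerm k l j) else 0ℚ) * x ^ l))
      ≡⟨ Σ-swap k k _ ⟩
        Σ[≤] k (λ j → Σ[≤] k (λ l → (if l ≤ᵇ j then ι (whitneyTerm k l j) else 0ℚ) * x ^ l))
      ≡⟨ Σ-cong k (λ j → Σ-cong k (whitneyTerm-rescaled k j)) ⟩
        Σ[≤] k (λ j → Σ[≤] k (λ l → ι (binom k j) * ι r ^ (k ∸ j) * (ι m ^ j * (ι (S j l) * (x * μ) ^ l))))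
      ≡⟨ Σ-cong-≤ k (λ j j≤k → bell-inner k j j≤k (ι (binom k j) * ι r ^ (k ∸ j))) ⟩
        BT (λ i → ι m ^ i * φ i (x * μ)) (ι r) k ∎
      where open ≡-Reasoning

open import Data.Nat using (ℕ; suc; NonZero; _∸_) renaming (_+_ to _+ℕ_)
open import Data.Nat.Combinatorics using (_C_)
open import Data.Integer using (+_)
open import Data.Rational using (ℚ; _/_; _*_; 1ℚ)
import Data.Rational.Properties as QP
open import Data.Rational.Solver using (module +-*-Solver)
open import Data.Product using (_×_; _,_)
open import Relation.Binary.PropositionalEquality
open FiniteSums
open Binomial
open Embedding
open Inversion
open BinomialTransform
open StirlingBell
open Dowling

inversion-rescaled : ∀ n (g : ℕ → ℚ) R ρ → R * ρ ≡ 1ℚ →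
  Σ[≤] n (λ k → weight n k * (ρ ^ k * g k)) ≡ Σ[≤] n (λ k → weight n k * sgn (n ∸ k) * (ρ ^ k * BT g R k))
inversion-rescaled n g R ρ Rρ≡1 = trans (inversion n (λ k → ρ ^ k * g k))
  (Σ-cong n (λ k → cong (weight n k * sgn (n ∸ k) *_) (sym (BT-rescale R ρ Rρ≡1 g k))))

weight-C : ∀ n k → ℕ→ℚ (n C k) * ℕ→ℚ ((n +ℕ k) C k) ≡ weight n k
weight-C n k = cong₂ _*_ (ℕ→ℚ-C n k) (ℕ→ℚ-C (n +ℕ k) k)
  where
  ℕ→ℚ-C : ∀ a b → ℕ→ℚ (a C b) ≡ ι (binom a b)
  ℕ→ℚ-C a b = trans (sym (ι≡ℕ→ℚ (a C b))) (cong ι (C≡binom a b))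

-- First identity: both sides are the two sides of the rescaled inversion formula
-- for g_i = m^i φ_i(x/m), the Dowling side by the binomial form of D_{m,r}.
identity₁ : ∀ m′ r′ n x → let m = suc m′; r = suc r′ in
  Σ[≤] n (λ k → ℕ→ℚ (n C k) * ℕ→ℚ ((n +ℕ k) C k) * ((+ m / r) ^ k) * φ k (x * (+ 1 / m)))
    ≡ Σ[≤] n (λ k → ℕ→ℚ (n C k) * ℕ→ℚ ((n +ℕ k) C k) * sgn (n ∸ k) * ((+ 1 / r) ^ k) * D m r k x)
identity₁ m′ r′ n x = begin
    Σ[≤] n (λ k → ℕ→ℚ (n C k) * ℕ→ℚ ((n +ℕ k) C k) * ((+ m / r) ^ k) * φ k (x * μ))
  ≡⟨ Σ-cong n lhs-term ⟩
    Σ[≤] n (λ k → weight n k * (ρ ^ k * g k))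
  ≡⟨ inversion-rescaled n g (ι r) ρ (ι-*-inverse r′) ⟩
    Σ[≤] n (λ k → weight n k * sgn (n ∸ k) * (ρ ^ k * BT g (ι r) k))
  ≡⟨ sym (Σ-cong n rhs-term) ⟩
    Σ[≤] n (λ k → ℕ→ℚ (n C k) * ℕ→ℚ ((n +ℕ k) C k) * sgn (n ∸ k) * (ρ ^ k) * D m r k x) ∎
  where
  open ≡-Reasoning
  open +-*-Solver
  m r : ℕ
  m = suc m′
  r = suc r′
  μ ρ : ℚ
  μ = + 1 / m
  ρ = + 1 / r
  g : ℕ → ℚ
  g i = ι m ^ i * φ i (x * μ)
  m/r≡ρ*m : + m / r ≡ ρ * ι m
  m/r≡ρ*m = trans (/-as-* m r′) (trans (cong (_* ρ) (sym (ι≡ℕ→ℚ m))) (QP.*-comm (ι m) ρ))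
  lhs-term : ∀ k → ℕ→ℚ (n C k) * ℕ→ℚ ((n +ℕ k) C k) * ((+ m / r) ^ k) * φ k (x * μ) ≡ weight n k * (ρ ^ k * g k)
  lhs-term k = trans
    (cong₂ (λ u v → u * v * φ k (x * μ)) (weight-C n k) (trans (cong (_^ k) m/r≡ρ*m) (^-distrib-* ρ (ι m) k)))
    (solve 4 (λ c p q f → c :* (p :* q) :* f := c :* (p :* (q :* f))) refl (weight n k) (ρ ^ k) (ι m ^ k) (φ k (x * μ)))
  rhs-term : ∀ k → ℕ→ℚ (n C k) * ℕ→ℚ ((n +ℕ k) C k) * sgn (n ∸ k) * (ρ ^ k) * D m r k x
                 ≡ weight n k * sgn (n ∸ k) * (ρ ^ k * BT g (ι r) k)
  rhs-term k = trans (cong (λ u → u * sgn (n ∸ k) * (ρ ^ k) * D m r k x) (weight-C n k))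
    (trans (QP.*-assoc (weight n k * sgn (n ∸ k)) (ρ ^ k) (D m r k x))
           (cong (λ z → weight n k * sgn (n ∸ k) * (ρ ^ k * z)) (dowling-as-transform m r μ (ι-*-inverse m′) x k)))

-- Second identity: the same formula for g_i = x^r φ_i(x), the Stirling side by the
-- closed form of Σ_j s(r,j) φ_{k+j}(x).
identity₂ : ∀ r′ n x → let r = suc r′ in
  Σ[≤] n (λ k → ℕ→ℚ (n C k) * ℕ→ℚ ((n +ℕ k) C k) * (x ^ r) * (φ k x * ((+ 1 / r) ^ k)))
    ≡ Σ[≤] n (λ k → ℕ→ℚ (n C k) * ℕ→ℚ ((n +ℕ k) C k) * sgn (n ∸ k) * ((+ 1 / r) ^ k)
        * Σ[≤] r (λ j → ℤ→ℚ (s r j) * φ (k +ℕ j) x))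
identity₂ r′ n x = begin
    Σ[≤] n (λ k → ℕ→ℚ (n C k) * ℕ→ℚ ((n +ℕ k) C k) * (x ^ r) * (φ k x * (ρ ^ k)))
  ≡⟨ Σ-cong n lhs-term ⟩
    Σ[≤] n (λ k → weight n k * (ρ ^ k * g k))
  ≡⟨ inversion-rescaled n g (ι r) ρ (ι-*-inverse r′) ⟩
    Σ[≤] n (λ k → weight n k * sgn (n ∸ k) * (ρ ^ k * BT g (ι r) k))
  ≡⟨ sym (Σ-cong n rhs-term) ⟩
    Σ[≤] n (λ k → ℕ→ℚ (n C k) * ℕ→ℚ ((n +ℕ k) C k) * sgn (n ∸ k) * (ρ ^ k) * fallingBell x r k) ∎
  where
  open ≡-Reasoning
  open +-*-Solver
  r : ℕ
  r = suc r′
  ρ : ℚ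
  ρ = + 1 / r
  g : ℕ → ℚ
  g i = x ^ r * φ i x
  lhs-term : ∀ k → ℕ→ℚ (n C k) * ℕ→ℚ ((n +ℕ k) C k) * (x ^ r) * (φ k x * (ρ ^ k)) ≡ weight n k * (ρ ^ k * g k)
  lhs-term k = trans (cong (λ u → u * (x ^ r) * (φ k x * (ρ ^ k))) (weight-C n k))
    (solve 4 (λ c p f q → c :* p :* (f :* q) := c :* (q :* (p :* f))) refl (weight n k) (x ^ r) (φ k x) (ρ ^ k))
  rhs-term : ∀ k → ℕ→ℚ (n C k) * ℕ→ℚ ((n +ℕ k) C k) * sgn (n ∸ k) * (ρ ^ k) * fallingBell x r k
                 ≡ weight n k * sgn (n ∸ k) * (ρ ^ k * BT g (ι r) k)
  rhs-term k = trans (cong (λ u → u * sgn (n ∸ k) * (ρ ^ k) * fallingBell x r k) (weight-C n k))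
    (trans (QP.*-assoc (weight n k * sgn (n ∸ k)) (ρ ^ k) (fallingBell x r k))
           (cong (λ z → weight n k * sgn (n ∸ k) * (ρ ^ k * z))
                 (trans (fallingBell-closed x r k) (sym (BT-scale (x ^ r) (λ i → φ i x) (ι r) k)))))

mainTheorem19 : (m r : ℕ) → .{{_ : NonZero m}} → .{{_ : NonZero r}} → (n : ℕ) → (x : ℚ) →
    (Σ[≤] n (λ k → ℕ→ℚ (n C k) * ℕ→ℚ ((n +ℕ k) C k) * ((+ m / r) ^ k) * φ k (x * (+ 1 / m)))
      ≡ Σ[≤] n (λ k → ℕ→ℚ (n C k) * ℕ→ℚ ((n +ℕ k) C k) * sgn (n ∸ k) * ((+ 1 / r) ^ k) * D m r k x))
    × (Σ[≤] n (λ k → ℕ→ℚ (n C k) * ℕ→ℚ ((n +ℕ k) C k) * (x ^ r) * (φ k x * ((+ 1 / r) ^ k)))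
      ≡ Σ[≤] n (λ k → ℕ→ℚ (n C k) * ℕ→ℚ ((n +ℕ k) C k) * sgn (n ∸ k) * ((+ 1 / r) ^ k)
          * Σ[≤] r (λ j → ℤ→ℚ (s r j) * φ (k +ℕ j) x)))
mainTheorem19 (suc m′) (suc r′) n x = identity₁ m′ r′ n x , identity₂ r′ n x
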